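{- Let $G=(V,E)$ be a finite undirected graph, let $\emptyset\neq V_0\subsetneq V_1\subsetneq\cdots\subsetneq V_k\subsetneq V$ be a chain, let $\mathcal{C}=\{\delta(V_0),\dots,\delta(V_k)\}$, and let $x$ be a chain-point for this chain. Suppose $x=\varepsilon y+(1-\varepsilon)x'$ with $y\in\mathrm{Sp}_{\mathcal{C}}(G)$, $x'\in\mathrm{Sp}(G)$ and $\varepsilon\in[0,1)$. Then $x'$ is a chain-point for the chain consisting of those sets $V_i$, $i\in\{0,1,\dots,k\}$, with $x(\delta(V_i))<2-\varepsilon$.
   Context: For $S_1,S_2\subseteq V$, $\delta(S_1,S_2)$ is the set of edges with one end in $S_1$ and the other in $S_2$; $E(S)=\delta(S,S)$; $\delta(S)=\delta(S,V\setminus S)$; $\delta(v)=\delta(\{v\})$. For $F\subseteq E$, $x(F)=\sum_{e\in F}x_e$; edge sets are identified with their incidence vectors. $\mathrm{Sp}(G)=\{x\in\mathbb{R}^E: x\ge 0,\ x(E(U))\le |U|-1 \text{ for all nonempty } U\subseteq V,\ x(E)=|V|-1\}$ is the spanning tree polytope. Given a chain $\emptyset\neq W_0\subsetneq\cdots\subsetneq W_m\subsetneq V$, set $W_{ -1}=\emptyset$, $W_{m+1}=V$, and level sets $L_i=W_i\setminus W_{i-1}$ ($i=0,\dots,m+1$). A vector $x\in\mathbb{R}^E$ is a chain-point for this chain if (i) $x\in\mathrm{Sp}(G)$; (ii) $x(\delta(W_0))=x(\delta(W_m))=1$ and $x(\delta(W_i))<2$ for $i=1,\dots,m-1$; (iii)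 $\sum_{v\in L_i}x(\delta(v))=2|L_i|$ for $i=1,\dots,m$. A Gao-tree for the chain $V_0\subsetneq\cdots\subsetneq V_k$ is a spanning tree of $G$ meeting each cut in $\mathcal{C}$ in exactly one edge; $\mathrm{Sp}_{\mathcal{C}}(G)$ denotes the convex hull of the incidence vectors of these Gao-trees. -}

module Defs where

open import Level using (0ℓ)
open import Data.Nat as ℕ using (ℕ; zero; suc)
open import Data.Fin as F using (Fin; inject₁; fromℕ; toℕ)
open import Data.Bool using (Bool; true; false; _∧_; _∨_; not; if_then_else_; T)
open import Data.Product using (Σ; ∃; ∃-syntax; _×_; _,_)
open import Relation.Binary.PropositionalEquality using (_≡_; _≢_)
open import Relation.Nullary using (¬_)
open import Relation.Binary.Structures using (IsTotalOrder)
open import Algebra.Structures using (IsCommutativeRing)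
open import Function.Bundles using (_⇔_)

-- Ordered fields (the stdlib has no reals; we work over an arbitrary
-- ordered field, of which ℝ is an instance).

record OrderedField : Set₁ where
  infixl 6 _+_ _-_
  infixl 7 _*_
  infix 4 _≤_ _<_
  field
    Carrier : Set
    _+_ _*_ : Carrier → Carrier → Carrier
    -_      : Carrier → Carrier
    0# 1#   : Carrier
    _≤_     : Carrier → Carrier → Set
    isCommutativeRing : IsCommutativeRing _≡_ _+_ _*_ -_ 0# 1#
    0≢1     : 0# ≢ 1#
    _⁻¹     : Carrier → Carrier
    ⁻¹-inverse : ∀ a → a ≢ 0# → a * (a ⁻¹) ≡ 1#
    isTotalOrder : IsTotalOrder _≡_ _≤_
    +-mono-≤ : ∀ {a b} c → a ≤ b → a + c ≤ b + c
    *-nonneg : ∀ {a b} → 0# ≤ a → 0# ≤ b → 0# ≤ a * b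

  _-_ : Carrier → Carrier → Carrier
  a - b = a + (- b)

  _<_ : Carrier → Carrier → Set
  a < b = a ≤ b × a ≢ b

  ⟦_⟧ : ℕ → Carrier
  ⟦ zero ⟧  = 0#
  ⟦ suc n ⟧ = 1# + ⟦ n ⟧

  2# : Carrier
  2# = 1# + 1#

sumFin : ∀ {A : Set} → (A → A → A) → A → ∀ {n} → (Fin n → A) → A
sumFin _⊕_ e {zero}  f = e
sumFin _⊕_ e {suc n} f = f F.zero ⊕ sumFin _⊕_ e (λ i → f (F.suc i))

count : ∀ {n} → (Fin n → Bool) → ℕ
count P = sumFin ℕ._+_ 0 (λ i → if P i then 1 else 0)

record Graph : Set where
  field
    n m   : ℕ
    ends₁ : Fin m → Fin n
    ends₂ : Fin m → Fin n
    loopless : ∀ e → ends₁ e ≢ ends₂ e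

module _ (G : Graph) where
  open Graph G

  VSet : Set
  VSet = Fin n → Bool

  ESet : Set
  ESet = Fin m → Bool

  fullV : VSet
  fullV _ = true

  _∖_ : VSet → VSet → VSet
  (A ∖ B) v = A v ∧ not (B v)

  ∁ : VSet → VSet
  ∁ A v = not (A v)

  single : Fin n → VSet
  single v w with v F.≟ w
  ... | Relation.Nullary.yes _ = true
  ... | Relation.Nullary.no  _ = false

  δ₂ : VSet → VSet → ESet
  δ₂ S₁ S₂ e = (S₁ (ends₁ e) ∧ S₂ (ends₂ e)) ∨ (S₂ (ends₁ e) ∧ S₁ (ends₂ e))

  Eof : VSet → ESet
  Eof S = δ₂ S S

  δ : VSet → ESet
  δ S = δ₂ S (∁ S)

  δv : Fin n → ESet
  δv v = δ (single v)

  allE : ESet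
  allE _ = true

  ∣_∣ : VSet → ℕ
  ∣ S ∣ = count S

  _⊆_ : VSet → VSet → Set
  A ⊆ B = ∀ v → T (A v) → T (B v)

  _⊊_ : VSet → VSet → Set
  A ⊊ B = A ⊆ B × ∃[ v ] (T (B v) × ¬ T (A v))

  Nonempty : VSet → Set
  Nonempty A = ∃[ v ] T (A v)

  data Reach (Tr : ESet) : Fin n → Fin n → Set where
    here : ∀ {u} → Reach Tr u u
    fwd  : ∀ {u} e → T (Tr e) → Reach Tr (ends₂ e) u → Reach Tr (ends₁ e) u
    bwd  : ∀ {u} e → T (Tr e) → Reach Tr (ends₁ e) u → Reach Tr (ends₂ e) u

  IsSpanningTree : ESet → Set
  IsSpanningTree Tr = (∀ u v → Reach Tr u v) × suc (count Tr) ≡ n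

  IsChain : (k : ℕ) → (Fin (suc k) → VSet) → Set
  IsChain k W =
    Nonempty (W F.zero)
    × (∀ (i : Fin k) → W (inject₁ i) ⊊ W (F.suc i))
    × W (fromℕ k) ⊊ fullV

  IsGaoTree : (k : ℕ) → (Fin (suc k) → VSet) → ESet → Set
  IsGaoTree k W Tr =
    IsSpanningTree Tr × (∀ i → count (λ e → Tr e ∧ δ (W i) e) ≡ 1)

  module _ (𝔽 : OrderedField) where
    open OrderedField 𝔽

    Vec𝔽 : Set
    Vec𝔽 = Fin m → Carrier

    Σ𝔽 : ∀ {N} → (Fin N → Carrier) → Carrier
    Σ𝔽 = sumFin _+_ 0#

    _⟨_⟩ : Vec𝔽 → ESet → Carrier
    x ⟨ Fs ⟩ = Σ𝔽 (λ e → if Fs e then x e else 0#)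

    χ : ESet → Vec𝔽
    χ Fs e = if Fs e then 1# else 0#

    InSp : Vec𝔽 → Set
    InSp x =
      (∀ e → 0# ≤ x e)
      × (∀ U → Nonempty U → x ⟨ Eof U ⟩ ≤ ⟦ ∣ U ∣ ⟧ - 1#)
      × x ⟨ allE ⟩ ≡ ⟦ n ⟧ - 1#

    InSpC : (k : ℕ) → (Fin (suc k) → VSet) → Vec𝔽 → Set
    InSpC k W y =
      ∃[ N ] Σ (Fin N → Carrier) λ λs → Σ (Fin N → ESet) λ Ts →
        (∀ j → 0# ≤ λs j)
        × (∀ j → IsGaoTree k W (Ts j))
        × Σ𝔽 λs ≡ 1#
        × (∀ e → y e ≡ Σ𝔽 (λ j → λs j * χ (Ts j) e))

    -- chain-point for the chain W₀ ⊊ ⋯ ⊊ W_k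
    -- (level sets L_i = W_i ∖ W_{i-1} for i = 1..k are indexed by i : Fin k
    --  as W (suc i) ∖ W (inject₁ i))
    IsChainPoint : (k : ℕ) → (Fin (suc k) → VSet) → Vec𝔽 → Set
    IsChainPoint k W x =
      IsChain k W
      × InSp x
      × x ⟨ δ (W F.zero) ⟩ ≡ 1#
      × x ⟨ δ (W (fromℕ k)) ⟩ ≡ 1#
      × (∀ (i : Fin (suc k)) → 0 ℕ.< toℕ i → toℕ i ℕ.< k → x ⟨ δ (W i) ⟩ < 2#)
      × (∀ (i : Fin k) →
           Σ𝔽 (λ v → if (W (F.suc i) ∖ W (inject₁ i)) v then x ⟨ δv v ⟩ else 0#)
             ≡ 2# * ⟦ ∣ W (F.suc i) ∖ W (inject₁ i) ∣ ⟧)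

module Submission where

-- Cut values x(δ(V)) and level degrees Σ_{v ∈ L} x(δ(v)) are linear in x, so
-- it suffices to know them for y and for x.  A Gao tree T has |T ∩ δ(V_i)| = 1
-- and degree 2|L| on every chain difference L = V_b ∖ V_a (a < b): a spanning
-- tree has at most |S| - 1 edges inside any nonempty S (union–find sweep), and
-- |T| = n - 1 then forces T to meet L in a tree joined to the rest by the two
-- cut edges; by convexity the same holds for y.  A chain-point has degree 2|L|
-- on every chain difference by telescoping its level conditions.  Since
-- K = εK + (1 - ε)t forces t = K when ε ≠ 1, the values 1 at the end cuts and
-- the level degrees pass to x′, and x(δ(V)) < 2 - ε gives x′(δ(V)) < 2.

open import Defs
open import Data.Nat using (ℕ; suc)
open import Data.Fin using (Fin; _<_)
open import Data.Product using (∃-syntax)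
open import Function.Base using (_∘_)
open import Function.Bundles using (_⇔_)
open import Relation.Binary.PropositionalEquality using (_≡_)

open import Level using (0ℓ)
open import Function.Bundles using (Equivalence)
open import Algebra.Bundles using (CommutativeMonoid; CommutativeRing)
open import Algebra.Structures using (IsCommutativeMonoid)
import Algebra.Properties.CommutativeMonoid.Sum as MonoidSum
import Algebra.Properties.CommutativeSemigroup as CommutativeSemigroupProperties
import Algebra.Properties.Group as GroupProperties
import Algebra.Properties.Ring as RingProperties
import Algebra.Properties.Semiring.Sum as SemiringSum
open import Algebra.Structures using (IsCommutativeRing)
open import Relation.Binary.Structures using (IsTotalOrder)
open import Data.Bool.Properties using (∨-commutativeMonoid; ∨-idem; ∧-zeroʳ; ∧-identityʳ; ∧-comm; T-≡; T-∧)
open import Data.Bool using (Bool; true; false; _∧_; _∨_; not; if_then_else_; T)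
open import Data.Empty using (⊥-elim)
open import Data.Fin as F using (zero; suc)
open import Data.Fin.Properties using (_≟_)
import Data.Fin.Properties as FP
open import Data.Fin.Induction using (<-weakInduction; <-weakInduction-startingFrom)
open import Data.Nat as ℕ using (z≤n; s≤s)
import Data.Nat.Properties as ℕₚ
open import Data.Nat.Tactic.RingSolver using (solve-∀)
open import Data.Product using (_×_; _,_; proj₁; proj₂)
open import Data.Unit using (tt)
open import Data.Sum using (inj₁; inj₂)
open import Relation.Binary.PropositionalEquality using (refl; sym; trans; cong; cong₂; subst; subst₂; _≢_; module ≡-Reasoning)
open import Relation.Nullary using (¬_; Dec; does; yes; no)
open import Relation.Nullary.Decidable using (dec-true; dec-false)

_==_ : ∀ {n} → Fin n → Fin n → Bool
v == w = does (v ≟ w)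

==-refl : ∀ {n} (v : Fin n) → (v == v) ≡ true
==-refl v = dec-true (v ≟ v) refl

==-false : ∀ {n} {v w : Fin n} → v ≢ w → (v == w) ≡ false
==-false {v = v} {w} = dec-false (v ≟ w)

==-sound : ∀ {n} (v w : Fin n) → (v == w) ≡ true → v ≡ w
==-sound v w = fromDec (v ≟ w)
  where
  fromDec : (d : Dec (v ≡ w)) → does d ≡ true → v ≡ w
  fromDec (yes v≡w) _ = v≡w

==-sym : ∀ {n} (v w : Fin n) → (v == w) ≡ (w == v)
==-sym v w with v ≟ w
... | yes refl = sym (==-refl v)
... | no v≢w = sym (==-false (v≢w ∘ sym))

𝟙 : Bool → ℕ
𝟙 b = if b then 1 else 0

inject₁<suc : ∀ {k} (i : Fin k) → F.inject₁ i < suc i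
inject₁<suc i = FP.≤̄⇒inject₁< (FP.≤-refl {x = i})

nested-ascending : ∀ {k n} (W : Fin (suc k) → Fin n → Bool) →
  (∀ j v → T (W (F.inject₁ j) v) → T (W (suc j) v)) →
  ∀ {i j} → i F.≤ j → ∀ v → T (W i v) → T (W j v)
nested-ascending W nested {i} = <-weakInduction-startingFrom (λ j → ∀ v → T (W i v) → T (W j v))
  (λ _ v∈Wi → v∈Wi) (λ j Wi⊆Wj v v∈Wi → nested j v (Wi⊆Wj v v∈Wi))

module Sums {A : Set} {_⊕_ : A → A → A} {e : A}
            (isCM : IsCommutativeMonoid _≡_ _⊕_ e) where
  open IsCommutativeMonoid isCM using (identityˡ; identityʳ)

  private
    monoid : CommutativeMonoid 0ℓ 0ℓ
    monoid = record { isCommutativeMonoid = isCM }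
    module Lib = MonoidSum monoid

  Σ : ∀ {n} → (Fin n → A) → A
  Σ = sumFin _⊕_ e

  Σ≡sum : ∀ {n} (f : Fin n → A) → Σ f ≡ Lib.sum f
  Σ≡sum {ℕ.zero} f = refl
  Σ≡sum {suc n} f = cong (f zero ⊕_) (Σ≡sum (f ∘ suc))

  Σ-cong : ∀ {n} {f g : Fin n → A} → (∀ i → f i ≡ g i) → Σ f ≡ Σ g
  Σ-cong {ℕ.zero} f≗g = refl
  Σ-cong {suc n} f≗g = cong₂ _⊕_ (f≗g zero) (Σ-cong (f≗g ∘ suc))

  Σ-zero : ∀ n → Σ {n} (λ _ → e) ≡ e
  Σ-zero n = trans (Σ≡sum {n} (λ _ → e)) (Lib.sum-replicate-zero n)

  Σ-+ : ∀ {n} (f g : Fin n → A) → Σ (λ i → f i ⊕ g i) ≡ Σ f ⊕ Σ g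
  Σ-+ f g = trans (Σ≡sum (λ i → f i ⊕ g i)) (trans (Lib.∑-distrib-+ f g) (sym (cong₂ _⊕_ (Σ≡sum f) (Σ≡sum g))))

  Σ-comm : ∀ {m n} (f : Fin m → Fin n → A) → Σ (λ i → Σ (f i)) ≡ Σ (λ j → Σ (λ i → f i j))
  Σ-comm {m} {n} f = begin
    Σ (λ i → Σ (f i))             ≡⟨ Σ-cong (Σ≡sum ∘ f) ⟩
    Σ (λ i → Lib.sum (f i))       ≡⟨ Σ≡sum (λ i → Lib.sum (f i)) ⟩
    Lib.sum (λ i → Lib.sum (f i)) ≡⟨ Lib.∑-comm f ⟩
    Lib.sum (λ j → Lib.sum (λ i → f i j)) ≡⟨ sym (Σ≡sum (λ j → Lib.sum (λ i → f i j))) ⟩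
    Σ (λ j → Lib.sum (λ i → f i j)) ≡⟨ sym (Σ-cong (λ j → Σ≡sum (λ i → f i j))) ⟩
    Σ (λ j → Σ (λ i → f i j))     ∎
    where open ≡-Reasoning

  Σ-point : ∀ {n} (a : Fin n) (c : Fin n → A) → Σ (λ v → if v == a then c v else e) ≡ c a
  Σ-point {suc n} zero c = trans (cong (c zero ⊕_) (Σ-zero n)) (identityʳ (c zero))
  Σ-point {suc n} (suc a) c = trans (identityˡ _) (Σ-point a (c ∘ suc))

  Σ⟨_⟩ : ∀ {n} → (Fin n → Bool) → (Fin n → A) → A
  Σ⟨ S ⟩ f = Σ (λ i → if S i then f i else e)

  Σ⟨⟩-split : ∀ {n} {P Q R : Fin n → Bool} (f : Fin n → A) →
    (∀ i → T (P i) → T (Q i)) → (∀ i → T (Q i) → T (R i)) →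
    Σ⟨ (λ i → R i ∧ not (P i)) ⟩ f ≡ Σ⟨ (λ i → Q i ∧ not (P i)) ⟩ f ⊕ Σ⟨ (λ i → R i ∧ not (Q i)) ⟩ f
  Σ⟨⟩-split {P = P} {Q} {R} f P⊆Q Q⊆R =
    trans (Σ-cong split) (Σ-+ (λ i → if Q i ∧ not (P i) then f i else e) (λ i → if R i ∧ not (Q i) then f i else e))
    where
    split : ∀ i → (if R i ∧ not (P i) then f i else e)
                ≡ (if Q i ∧ not (P i) then f i else e) ⊕ (if R i ∧ not (Q i) then f i else e)
    split i with P i | Q i | R i | P⊆Q i | Q⊆R i
    ... | true  | false | _     | p | _ = ⊥-elim (p tt)
    ... | _     | true  | false | _ | q = ⊥-elim (q tt)
    ... | true  | true  | true  | _ | _ = sym (identityˡ e)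
    ... | false | true  | true  | _ | _ = sym (identityʳ (f i))
    ... | false | false | true  | _ | _ = sym (identityˡ (f i))
    ... | false | false | false | _ | _ = sym (identityˡ e)

  Σ⟨⟩-empty : ∀ {n} (P : Fin n → Bool) (f : Fin n → A) → Σ⟨ (λ i → P i ∧ not (P i)) ⟩ f ≡ e
  Σ⟨⟩-empty {n} P f = trans (Σ-cong none) (Σ-zero n)
    where
    none : ∀ i → (if P i ∧ not (P i) then f i else e) ≡ e
    none i with P i
    ... | true  = refl
    ... | false = refl

  -- Two additive set functions Σ⟨_⟩ f and Σ⟨_⟩ g that agree on the levels
  -- W_{j+1} ∖ W_j of a nested family agree on every difference W_b ∖ W_a, a ≤ b
  -- (provided ⊕ is cancellative): both telescope from W₀.
  Σ⟨⟩-levels-agree : (∀ x y z → x ⊕ y ≡ x ⊕ z → y ≡ z) →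
    ∀ {k n} (W : Fin (suc k) → Fin n → Bool) (f g : Fin n → A) →
    (nested : ∀ j v → T (W (F.inject₁ j) v) → T (W (suc j) v)) →
    (∀ j → Σ⟨ (λ v → W (suc j) v ∧ not (W (F.inject₁ j) v)) ⟩ f ≡ Σ⟨ (λ v → W (suc j) v ∧ not (W (F.inject₁ j) v)) ⟩ g) →
    ∀ {a b} → a F.≤ b → Σ⟨ (λ v → W b v ∧ not (W a v)) ⟩ f ≡ Σ⟨ (λ v → W b v ∧ not (W a v)) ⟩ g
  Σ⟨⟩-levels-agree cancel {k} {n} W f g nested levels-agree {a} {b} a≤b = cancel (diff a zero f) _ _ (begin
      diff a zero f ⊕ diff b a f   ≡⟨ sym (split f a≤b) ⟩
      diff b zero f                ≡⟨ from-W₀ b ⟩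
      diff b zero g                ≡⟨ split g a≤b ⟩
      diff a zero g ⊕ diff b a g   ≡⟨ cong (_⊕ diff b a g) (sym (from-W₀ a)) ⟩
      diff a zero f ⊕ diff b a g   ∎)
    where
    open ≡-Reasoning
    diff : Fin (suc k) → Fin (suc k) → (Fin n → A) → A
    diff j i h = Σ⟨ (λ v → W j v ∧ not (W i v)) ⟩ h
    split : ∀ h {a b} → a F.≤ b → diff b zero h ≡ diff a zero h ⊕ diff b a h
    split h a≤b = Σ⟨⟩-split h (nested-ascending W nested z≤n) (nested-ascending W nested a≤b)
    from-W₀ : ∀ j → diff j zero f ≡ diff j zero g
    from-W₀ = <-weakInduction (λ j → diff j zero f ≡ diff j zero g)
      (trans (Σ⟨⟩-empty (W zero) f) (sym (Σ⟨⟩-empty (W zero) g)))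
      (λ j agree → trans (split f (ℕₚ.<⇒≤ (inject₁<suc j)))
                     (trans (cong₂ _⊕_ agree (levels-agree j)) (sym (split g (ℕₚ.<⇒≤ (inject₁<suc j))))))

module ℕΣ = Sums ℕₚ.+-0-isCommutativeMonoid

Σℕ-mono : ∀ {n} {f g : Fin n → ℕ} → (∀ i → f i ℕ.≤ g i) → ℕΣ.Σ f ℕ.≤ ℕΣ.Σ g
Σℕ-mono {ℕ.zero} f≤g = z≤n
Σℕ-mono {suc n} f≤g = ℕₚ.+-mono-≤ (f≤g zero) (Σℕ-mono (f≤g ∘ suc))

count-mono : ∀ {n} {P Q : Fin n → Bool} → (∀ i → T (P i) → T (Q i)) → count P ℕ.≤ count Q
count-mono {P = P} {Q} P⊆Q = Σℕ-mono pointwise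
  where
  pointwise : ∀ i → 𝟙 (P i) ℕ.≤ 𝟙 (Q i)
  pointwise i with P i | Q i | P⊆Q i
  ... | false | _     | _ = z≤n
  ... | true  | true  | _ = s≤s z≤n
  ... | true  | false | p = ⊥-elim (p tt)

count-point : ∀ {n} (a : Fin n) → count (_== a) ≡ 1
count-point a = ℕΣ.Σ-point a (λ _ → 1)

count-all : ∀ n → count {n} (λ _ → true) ≡ n
count-all ℕ.zero = refl
count-all (suc n) = cong suc (count-all n)

some : ∀ {n} → (Fin n → Bool) → Bool
some {ℕ.zero} P = false
some {suc n} P = P zero ∨ some (P ∘ suc)

some-intro : ∀ {n} (P : Fin n → Bool) i → P i ≡ true → some P ≡ true
some-intro P zero Pi rewrite Pi = refl
some-intro P (suc i) Pi with P zero
... | true  = refl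
... | false = some-intro (P ∘ suc) i Pi

some-elim : ∀ {n} (P : Fin n → Bool) → some P ≡ true → ∃[ i ] P i ≡ true
some-elim {suc n} P holds with P zero in P0
... | true  = zero , P0
... | false with some-elim (P ∘ suc) holds
...   | i , Pi = suc i , Pi

some-cong : ∀ {n} {P Q : Fin n → Bool} → (∀ i → P i ≡ Q i) → some P ≡ some Q
some-cong {ℕ.zero} P≗Q = refl
some-cong {suc n} P≗Q = cong₂ _∨_ (P≗Q zero) (some-cong (P≗Q ∘ suc))

some-none : ∀ {n} {P : Fin n → Bool} → (∀ i → P i ≡ false) → some P ≡ false
some-none {ℕ.zero} none = refl
some-none {suc n} none rewrite none zero = some-none (none ∘ suc)

some-∨ : ∀ {n} (P Q : Fin n → Bool) → some (λ i → P i ∨ Q i) ≡ some P ∨ some Q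
some-∨ {ℕ.zero} P Q = refl
some-∨ {suc n} P Q rewrite some-∨ (P ∘ suc) (Q ∘ suc) =
  ∨-interchange (P zero) (Q zero) (some (P ∘ suc)) (some (Q ∘ suc))
  where
  open CommutativeSemigroupProperties (CommutativeMonoid.commutativeSemigroup ∨-commutativeMonoid)
    renaming (interchange to ∨-interchange)

-- Proof by a union–find sweep: every vertex starts with its own label and
-- the edges are processed in turn; a tree edge whose ends carry different
-- labels a ≠ b renames a to b (a merge), a tree edge whose ends already agree
-- is redundant.  Each tree edge inside S merges two labels used on S or is
-- redundant, so  #(edges inside S) + #(labels on S at the end) ≤ |S| + #redundant.
-- On all of V each merge removes exactly one label, so  n + #redundant ≤ |T| +
-- #(labels at the end); connectivity leaves one label and |T| = n - 1, hence
-- nothing is redundant, and the (at least one) label left on S gives the bound.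

module SpanningTreeSparsity (G : Graph) where
  open Graph G

  Labelling : Set
  Labelling = Fin n → Fin n

  used : VSet G → Labelling → Fin n → Bool
  used S l w = some (λ v → S v ∧ (l v == w))

  #labels : VSet G → Labelling → ℕ
  #labels S l = count (used S l)

  rename : Fin n → Fin n → Labelling → Labelling
  rename a b l v = if l v == a then b else l v

  used-own : ∀ S l u → S u ≡ true → used S l (l u) ≡ true
  used-own S l u Su = some-intro (λ v → S v ∧ (l v == l u)) u (trans (cong (_∧ (l u == l u)) Su) (==-refl (l u)))

  #labels-identity : ∀ S → #labels S (λ v → v) ≡ count S
  #labels-identity S = ℕΣ.Σ-cong (λ w → cong 𝟙 (used-id w))
    where
    used-id : ∀ w → used S (λ v → v) w ≡ S w
    used-id w with S w in Sw
    ... | true  = some-intro (λ v → S v ∧ (v == w)) w (trans (cong (_∧ (w == w)) Sw) (==-refl w))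
    ... | false = some-none other
      where
      other : ∀ v → (S v ∧ (v == w)) ≡ false
      other v with v == w in v=w
      ... | true rewrite ==-sound v w v=w = trans (∧-identityʳ (S w)) Sw
      ... | false = ∧-zeroʳ (S v)

  -- Renaming a to b, counted label by label: label a disappears (if used),
  -- label b appears (if a was used and b was not), all others are unchanged.
  rename-count-at : ∀ S a b l → a ≢ b → ∀ w →
    𝟙 (used S (rename a b l) w) ℕ.+ (if w == a then 𝟙 (used S l a) else 0)
      ≡ 𝟙 (used S l w) ℕ.+ (if w == b then 𝟙 (used S l a ∧ not (used S l b)) else 0)
  rename-count-at S a b l a≢b w with w == a in w=a
  ... | true rewrite ==-sound w a w=a | ==-false a≢b =
          trans (cong (λ u → 𝟙 u ℕ.+ 𝟙 (used S l a)) (some-none gone)) (sym (ℕₚ.+-identityʳ _))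
    where
    gone : ∀ v → (S v ∧ (rename a b l v == a)) ≡ false
    gone v with l v == a in e
    ... | true rewrite ==-false (a≢b ∘ sym) = ∧-zeroʳ (S v)
    ... | false rewrite e = ∧-zeroʳ (S v)
  ... | false with w == b in w=b
  ...   | true rewrite ==-sound w b w=b =
            trans (ℕₚ.+-identityʳ _)
              (trans (cong 𝟙 (trans (some-cong merged) (some-∨ (λ v → S v ∧ (l v == a)) (λ v → S v ∧ (l v == b)))))
                (join (used S l a) (used S l b)))
    where
    merged : ∀ v → (S v ∧ (rename a b l v == b)) ≡ ((S v ∧ (l v == a)) ∨ (S v ∧ (l v == b)))
    merged v with l v == a in e
    ... | true rewrite ==-refl b | ==-sound (l v) a e | ==-false a≢b with S v
    ...   | true  = refl
    ...   | false = refl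
    merged v | false with S v
    ...   | true  = refl
    ...   | false = refl
    join : ∀ x y → 𝟙 (x ∨ y) ≡ 𝟙 y ℕ.+ 𝟙 (x ∧ not y)
    join true  true  = refl
    join true  false = refl
    join false true  = refl
    join false false = refl
  ...   | false = trans (ℕₚ.+-identityʳ _) (trans (cong 𝟙 (some-cong unchanged)) (sym (ℕₚ.+-identityʳ _)))
    where
    unchanged : ∀ v → (S v ∧ (rename a b l v == w)) ≡ (S v ∧ (l v == w))
    unchanged v with l v == a in e
    ... | true rewrite ==-sound (l v) a e | ==-sym b w | w=b | ==-sym a w | w=a = refl
    ... | false = refl

  rename-count : ∀ S a b l → a ≢ b →
    #labels S (rename a b l) ℕ.+ 𝟙 (used S l a) ≡ #labels S l ℕ.+ 𝟙 (used S l a ∧ not (used S l b))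
  rename-count S a b l a≢b = begin
    #labels S l′ ℕ.+ 𝟙 (used S l a)
      ≡⟨ cong (#labels S l′ ℕ.+_) (sym (ℕΣ.Σ-point a (λ _ → 𝟙 (used S l a)))) ⟩
    #labels S l′ ℕ.+ ℕΣ.Σ lost
      ≡⟨ sym (ℕΣ.Σ-+ (𝟙 ∘ used S l′) lost) ⟩
    ℕΣ.Σ (λ w → 𝟙 (used S l′ w) ℕ.+ lost w)
      ≡⟨ ℕΣ.Σ-cong (rename-count-at S a b l a≢b) ⟩
    ℕΣ.Σ (λ w → 𝟙 (used S l w) ℕ.+ gained w)
      ≡⟨ ℕΣ.Σ-+ (𝟙 ∘ used S l) gained ⟩
    #labels S l ℕ.+ ℕΣ.Σ gained
      ≡⟨ cong (#labels S l ℕ.+_) (ℕΣ.Σ-point b (λ _ → 𝟙 (used S l a ∧ not (used S l b)))) ⟩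
    #labels S l ℕ.+ 𝟙 (used S l a ∧ not (used S l b)) ∎
    where
    open ≡-Reasoning
    l′ = rename a b l
    lost gained : Fin n → ℕ
    lost w = if w == a then 𝟙 (used S l a) else 0
    gained w = if w == b then 𝟙 (used S l a ∧ not (used S l b)) else 0

  module Sweep (Tr : ESet G) where

    redundant : Fin m → Labelling → Bool
    redundant e l = Tr e ∧ (l (ends₁ e) == l (ends₂ e))

    step : Fin m → Labelling → Labelling
    step e l = if Tr e ∧ not (l (ends₁ e) == l (ends₂ e))
               then rename (l (ends₁ e)) (l (ends₂ e)) l else l

    sweep : ∀ {K} → (Fin K → Fin m) → Labelling → Labelling
    sweep {ℕ.zero} es l = l
    sweep {suc K} es l = sweep (es ∘ suc) (step (es zero) l)

    #redundant : ∀ {K} → (Fin K → Fin m) → Labelling → ℕ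
    #redundant {ℕ.zero} es l = 0
    #redundant {suc K} es l = 𝟙 (redundant (es zero) l) ℕ.+ #redundant (es ∘ suc) (step (es zero) l)

    distinct-ends : ∀ (e : Fin m) (l : Labelling) → (l (ends₁ e) == l (ends₂ e)) ≡ false → l (ends₁ e) ≢ l (ends₂ e)
    distinct-ends e l differ same
      with () ← trans (sym (==-refl (l (ends₁ e)))) (trans (cong (l (ends₁ e) ==_) same) differ)

    step-inside : ∀ S e l →
      𝟙 (Tr e ∧ Eof G S e) ℕ.+ #labels S (step e l) ℕ.≤ #labels S l ℕ.+ 𝟙 (redundant e l)
    step-inside S e l with Tr e | l (ends₁ e) == l (ends₂ e) in ends=
    ... | false | _     = ℕₚ.≤-reflexive (ℕₚ.+-comm 0 _)
    ... | true  | true  = ℕₚ.≤-trans (ℕₚ.+-monoˡ-≤ (#labels S l) (indicator≤1 (Eof G S e)))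
                                     (ℕₚ.≤-reflexive (ℕₚ.+-comm 1 _))
      where
      indicator≤1 : ∀ b → 𝟙 b ℕ.≤ 1
      indicator≤1 true  = s≤s z≤n
      indicator≤1 false = z≤n
    ... | true  | false = by-inside (Eof G S e) refl
      where
      a = l (ends₁ e)
      b = l (ends₂ e)
      counted = rename-count S a b l (distinct-ends e l ends=)
      by-inside : ∀ t → Eof G S e ≡ t → 𝟙 t ℕ.+ #labels S (rename a b l) ℕ.≤ #labels S l ℕ.+ 0
      by-inside true inside = ℕₚ.≤-reflexive (trans (ℕₚ.+-comm 1 _)
          (trans (subst (λ u → #labels S (rename a b l) ℕ.+ 𝟙 u ≡ #labels S l ℕ.+ 𝟙 (u ∧ not (used S l b))) a-used counted)
                 (cong (λ u → #labels S l ℕ.+ 𝟙 (true ∧ not u)) b-used)))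
        where
        ends-in-S = Equivalence.to T-∧ (Equivalence.from T-≡ (trans (sym (∨-idem _)) inside))
        a-used = used-own S l (ends₁ e) (Equivalence.to T-≡ (proj₁ ends-in-S))
        b-used = used-own S l (ends₂ e) (Equivalence.to T-≡ (proj₂ ends-in-S))
      by-inside false _ = ℕₚ.≤-trans (never-more (used S l a) (used S l b) counted)
                                     (ℕₚ.≤-reflexive (sym (ℕₚ.+-identityʳ _)))
        where
        never-more : ∀ x y → #labels S (rename a b l) ℕ.+ 𝟙 x ≡ #labels S l ℕ.+ 𝟙 (x ∧ not y) →
                     #labels S (rename a b l) ℕ.≤ #labels S l
        never-more true  true  eq = ℕₚ.+-cancelʳ-≤ 1 _ _ (ℕₚ.≤-trans (ℕₚ.≤-reflexive eq) (ℕₚ.+-monoʳ-≤ (#labels S l) z≤n))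
        never-more true  false eq = ℕₚ.+-cancelʳ-≤ 1 _ _ (ℕₚ.≤-reflexive eq)
        never-more false y     eq = ℕₚ.≤-reflexive (ℕₚ.+-cancelʳ-≡ 0 _ _ eq)

    step-all : ∀ e l → #labels (fullV G) l ℕ.+ 𝟙 (redundant e l) ℕ.≤ 𝟙 (Tr e) ℕ.+ #labels (fullV G) (step e l)
    step-all e l with Tr e | l (ends₁ e) == l (ends₂ e) in ends=
    ... | false | _     = ℕₚ.≤-reflexive (ℕₚ.+-comm _ 0)
    ... | true  | true  = ℕₚ.≤-reflexive (ℕₚ.+-comm _ 1)
    ... | true  | false = begin
        #labels (fullV G) l ℕ.+ 0                            ≡⟨ ℕₚ.+-identityʳ _ ⟩
        #labels (fullV G) l                                  ≤⟨ ℕₚ.m≤m+n _ _ ⟩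
        #labels (fullV G) l ℕ.+ 𝟙 (true ∧ not (used (fullV G) l b)) ≡⟨ sym counted ⟩
        #labels (fullV G) (rename a b l) ℕ.+ 1               ≡⟨ ℕₚ.+-comm _ 1 ⟩
        1 ℕ.+ #labels (fullV G) (rename a b l)               ∎
      where
      open ℕₚ.≤-Reasoning
      a = l (ends₁ e)
      b = l (ends₂ e)
      counted : #labels (fullV G) (rename a b l) ℕ.+ 1 ≡ #labels (fullV G) l ℕ.+ 𝟙 (true ∧ not (used (fullV G) l b))
      counted = subst (λ u → #labels (fullV G) (rename a b l) ℕ.+ 𝟙 u ≡ #labels (fullV G) l ℕ.+ 𝟙 (u ∧ not (used (fullV G) l b)))
                      (used-own (fullV G) l (ends₁ e) refl) (rename-count (fullV G) a b l (distinct-ends e l ends=))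

    sweep-inside : ∀ {K} (es : Fin K → Fin m) S l →
      ℕΣ.Σ (λ i → 𝟙 (Tr (es i) ∧ Eof G S (es i))) ℕ.+ #labels S (sweep es l) ℕ.≤ #labels S l ℕ.+ #redundant es l
    sweep-inside {ℕ.zero} es S l = ℕₚ.≤-reflexive (ℕₚ.+-comm 0 _)
    sweep-inside {suc K} es S l = begin
        (first ℕ.+ rest) ℕ.+ #labels S (sweep (es ∘ suc) l′)   ≡⟨ ℕₚ.+-assoc first rest _ ⟩
        first ℕ.+ (rest ℕ.+ #labels S (sweep (es ∘ suc) l′))   ≤⟨ ℕₚ.+-monoʳ-≤ first (sweep-inside (es ∘ suc) S l′) ⟩
        first ℕ.+ (#labels S l′ ℕ.+ #redundant (es ∘ suc) l′)   ≡⟨ sym (ℕₚ.+-assoc first _ _) ⟩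
        (first ℕ.+ #labels S l′) ℕ.+ #redundant (es ∘ suc) l′   ≤⟨ ℕₚ.+-monoˡ-≤ _ (step-inside S (es zero) l) ⟩
        (#labels S l ℕ.+ 𝟙 (redundant (es zero) l)) ℕ.+ #redundant (es ∘ suc) l′ ≡⟨ ℕₚ.+-assoc (#labels S l) _ _ ⟩
        #labels S l ℕ.+ #redundant es l                        ∎
      where
      open ℕₚ.≤-Reasoning
      l′ = step (es zero) l
      first = 𝟙 (Tr (es zero) ∧ Eof G S (es zero))
      rest = ℕΣ.Σ (λ i → 𝟙 (Tr (es (suc i)) ∧ Eof G S (es (suc i))))

    sweep-all : ∀ {K} (es : Fin K → Fin m) l →
      #labels (fullV G) l ℕ.+ #redundant es l ℕ.≤ ℕΣ.Σ (λ i → 𝟙 (Tr (es i))) ℕ.+ #labels (fullV G) (sweep es l)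
    sweep-all {ℕ.zero} es l = ℕₚ.≤-reflexive (ℕₚ.+-comm _ 0)
    sweep-all {suc K} es l = begin
        #labels V l ℕ.+ (𝟙 (redundant (es zero) l) ℕ.+ #redundant (es ∘ suc) l′) ≡⟨ sym (ℕₚ.+-assoc (#labels V l) _ _) ⟩
        (#labels V l ℕ.+ 𝟙 (redundant (es zero) l)) ℕ.+ #redundant (es ∘ suc) l′ ≤⟨ ℕₚ.+-monoˡ-≤ _ (step-all (es zero) l) ⟩
        (first ℕ.+ #labels V l′) ℕ.+ #redundant (es ∘ suc) l′   ≡⟨ ℕₚ.+-assoc first _ _ ⟩
        first ℕ.+ (#labels V l′ ℕ.+ #redundant (es ∘ suc) l′)   ≤⟨ ℕₚ.+-monoʳ-≤ first (sweep-all (es ∘ suc) l′) ⟩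
        first ℕ.+ (rest ℕ.+ #labels V (sweep (es ∘ suc) l′))   ≡⟨ sym (ℕₚ.+-assoc first rest _) ⟩
        (first ℕ.+ rest) ℕ.+ #labels V (sweep es l)            ∎
      where
      open ℕₚ.≤-Reasoning
      V = fullV G
      l′ = step (es zero) l
      first = 𝟙 (Tr (es zero))
      rest = ℕΣ.Σ (λ i → 𝟙 (Tr (es (suc i))))

    step-respects : ∀ e l u v → l u ≡ l v → step e l u ≡ step e l v
    step-respects e l u v lu=lv with Tr e ∧ not (l (ends₁ e) == l (ends₂ e))
    ... | false = lu=lv
    ... | true rewrite lu=lv = refl

    sweep-respects : ∀ {K} (es : Fin K → Fin m) l u v → l u ≡ l v → sweep es l u ≡ sweep es l v
    sweep-respects {ℕ.zero} es l u v lu=lv = lu=lv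
    sweep-respects {suc K} es l u v lu=lv = sweep-respects (es ∘ suc) _ u v (step-respects (es zero) l u v lu=lv)

    step-joins : ∀ e l → T (Tr e) → step e l (ends₁ e) ≡ step e l (ends₂ e)
    step-joins e l inTr with Tr e | l (ends₁ e) == l (ends₂ e) in ends=
    ... | true | true  = ==-sound _ _ ends=
    ... | true | false rewrite ==-refl (l (ends₁ e)) | ==-sym (l (ends₂ e)) (l (ends₁ e)) | ends= = refl

    sweep-joins : ∀ {K} (es : Fin K → Fin m) l i → T (Tr (es i)) →
      sweep es l (ends₁ (es i)) ≡ sweep es l (ends₂ (es i))
    sweep-joins {suc K} es l zero inTr = sweep-respects (es ∘ suc) _ _ _ (step-joins (es zero) l inTr)
    sweep-joins {suc K} es l (suc i) inTr = sweep-joins (es ∘ suc) _ i inTr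

  spanning-tree-sparse : ∀ Tr → IsSpanningTree G Tr → ∀ S → Nonempty G S →
    suc (count (λ e → Tr e ∧ Eof G S e)) ℕ.≤ count S
  spanning-tree-sparse Tr (connected , size) S (s , s∈S) = begin
      suc inside                            ≡⟨ ℕₚ.+-comm 1 inside ⟩
      inside ℕ.+ 1                          ≤⟨ ℕₚ.+-monoʳ-≤ inside S-keeps-a-label ⟩
      inside ℕ.+ #labels S final            ≤⟨ sweep-inside (λ e → e) S (λ v → v) ⟩
      #labels S (λ v → v) ℕ.+ #redundant (λ e → e) (λ v → v) ≡⟨ cong₂ ℕ._+_ (#labels-identity S) no-redundant ⟩
      count S ℕ.+ 0                         ≡⟨ ℕₚ.+-identityʳ _ ⟩
      count S                               ∎
    where
    open Sweep Tr
    open ℕₚ.≤-Reasoning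
    inside = count (λ e → Tr e ∧ Eof G S e)
    final = sweep (λ e → e) (λ v → v)
    C = #redundant (λ e → e) (λ v → v)

    same-label : ∀ u v → Reach G Tr u v → final u ≡ final v
    same-label u .u here = refl
    same-label .(ends₁ e) u (fwd e inTr r) = trans (sweep-joins (λ e → e) (λ v → v) e inTr) (same-label _ _ r)
    same-label .(ends₂ e) u (bwd e inTr r) = trans (sym (sweep-joins (λ e → e) (λ v → v) e inTr)) (same-label _ _ r)

    one-label : #labels (fullV G) final ℕ.≤ 1
    one-label = ℕₚ.≤-trans (count-mono only-s) (ℕₚ.≤-reflexive (count-point (final s)))
      where
      only-s : ∀ w → T (used (fullV G) final w) → T (w == final s)
      only-s w w-used with some-elim (λ v → final v == w) (Equivalence.to T-≡ w-used)
      ... | v , fv=w rewrite sym (==-sound (final v) w fv=w) | same-label v s (connected v s) =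
            Equivalence.from T-≡ (==-refl (final s))

    n+C≤n : n ℕ.+ C ℕ.≤ n ℕ.+ 0
    n+C≤n = begin
        n ℕ.+ C                              ≡⟨ cong (ℕ._+ C) (sym (count-all n)) ⟩
        count {n} (λ _ → true) ℕ.+ C         ≡⟨ cong (ℕ._+ C) (sym (#labels-identity (fullV G))) ⟩
        #labels (fullV G) (λ v → v) ℕ.+ C    ≤⟨ sweep-all (λ e → e) (λ v → v) ⟩
        count Tr ℕ.+ #labels (fullV G) final ≤⟨ ℕₚ.+-monoʳ-≤ (count Tr) one-label ⟩
        count Tr ℕ.+ 1                       ≡⟨ trans (ℕₚ.+-comm (count Tr) 1) size ⟩
        n                                    ≡⟨ sym (ℕₚ.+-identityʳ n) ⟩
        n ℕ.+ 0                              ∎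

    no-redundant : C ≡ 0
    no-redundant = ℕₚ.n≤0⇒n≡0 (ℕₚ.+-cancelˡ-≤ n C 0 n+C≤n)

    S-keeps-a-label : 1 ℕ.≤ #labels S final
    S-keeps-a-label = ℕₚ.≤-trans (ℕₚ.≤-reflexive (sym (count-point (final s)))) (count-mono own-label)
      where
      own-label : ∀ w → T (w == final s) → T (used S final w)
      own-label w w=fs rewrite ==-sound w (final s) (Equivalence.to T-≡ w=fs) =
        Equivalence.from T-≡ (used-own S final s (Equivalence.to T-≡ s∈S))

tree-degree : (G : Graph) → ESet G → VSet G → ℕ
tree-degree G Tr L = ℕΣ.Σ (λ e → if Tr e then 𝟙 (L (ends₁ e)) ℕ.+ 𝟙 (L (ends₂ e)) else 0)
  where open Graph G

-- With p, l, q the tree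
-- edges inside A, L = B ∖ A and V ∖ B, u the tree edges crossing δ(A) ∪ δ(B)
-- and i those crossing both cuts: |T| + 1 = n and the sparsity bounds
-- |A| = p+1+a, |L| = l+1+b, |V∖B| = q+1+c force u ≥ 2; as |T ∩ δ(A)| +
-- |T ∩ δ(B)| = u + i = 2, all slacks a, b, c and i vanish, and the degree
-- d of L in T, which satisfies d + 2i = 2l + 2, equals 2|L|.
private
  tree-size-rearranged : ∀ p l q u → suc (p ℕ.+ (l ℕ.+ (q ℕ.+ u))) ≡ p ℕ.+ (l ℕ.+ (q ℕ.+ suc u))
  tree-size-rearranged = solve-∀
  vertex-count-rearranged : ∀ p l q a b c →
    (suc p ℕ.+ a) ℕ.+ ((suc l ℕ.+ b) ℕ.+ (suc q ℕ.+ c)) ≡ p ℕ.+ (l ℕ.+ (q ℕ.+ (3 ℕ.+ (a ℕ.+ (b ℕ.+ c)))))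
  vertex-count-rearranged = solve-∀
  level-size-doubled : ∀ l → (l ℕ.+ l) ℕ.+ 2 ≡ (suc l ℕ.+ 0) ℕ.+ (suc l ℕ.+ 0)
  level-size-doubled = solve-∀

level-arithmetic : ∀ p l q u i d a b c |L| →
  suc (p ℕ.+ (l ℕ.+ (q ℕ.+ u))) ≡ (suc p ℕ.+ a) ℕ.+ ((suc l ℕ.+ b) ℕ.+ (suc q ℕ.+ c)) →
  2 ≡ u ℕ.+ i →
  d ℕ.+ (i ℕ.+ i) ≡ (l ℕ.+ l) ℕ.+ 2 →
  suc l ℕ.+ b ≡ |L| →
  d ≡ |L| ℕ.+ |L|
level-arithmetic p l q u i d a b c |L| tree-size cuts degree level-size = conclude i b |L| i≡0 b≡0 degree level-size
  where
  slack = a ℕ.+ (b ℕ.+ c)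
  u≡2+slack : u ≡ 2 ℕ.+ slack
  u≡2+slack = cong ℕ.pred (ℕₚ.+-cancelˡ-≡ q _ _ (ℕₚ.+-cancelˡ-≡ l _ _ (ℕₚ.+-cancelˡ-≡ p _ _
                (trans (sym (tree-size-rearranged p l q u)) (trans tree-size (vertex-count-rearranged p l q a b c))))))
  slack+i≡0 : slack ℕ.+ i ≡ 0
  slack+i≡0 = ℕₚ.+-cancelˡ-≡ 2 _ _ (sym (trans cuts (trans (cong (ℕ._+ i) u≡2+slack) (ℕₚ.+-assoc 2 slack i))))
  i≡0 = ℕₚ.m+n≡0⇒n≡0 slack slack+i≡0
  b≡0 = ℕₚ.m+n≡0⇒m≡0 b (ℕₚ.m+n≡0⇒n≡0 a (ℕₚ.m+n≡0⇒m≡0 slack slack+i≡0))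
  conclude : ∀ i b |L| → i ≡ 0 → b ≡ 0 → d ℕ.+ (i ℕ.+ i) ≡ (l ℕ.+ l) ℕ.+ 2 → suc l ℕ.+ b ≡ |L| → d ≡ |L| ℕ.+ |L|
  conclude .0 .0 .(suc l ℕ.+ 0) refl refl degree refl = trans (sym (ℕₚ.+-identityʳ d)) (trans degree (level-size-doubled l))

-- Three identities between indicators of a single edge e, for nested A ⊆ B,
-- in terms of t = [e ∈ T] and the memberships of its ends in A and B:
-- the edge lies inside A, inside B ∖ A, inside V ∖ B, or crosses δ(A) ∪ δ(B);
-- inclusion–exclusion for δ(A), δ(B); and the count of its ends in B ∖ A.
record EdgeIdentities (t a₁ b₁ a₂ b₂ : Bool) : Set where
  private
    inA   = (a₁ ∧ a₂) ∨ (a₁ ∧ a₂)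
    inL   = ((b₁ ∧ not a₁) ∧ (b₂ ∧ not a₂)) ∨ ((b₁ ∧ not a₁) ∧ (b₂ ∧ not a₂))
    inQ   = (not b₁ ∧ not b₂) ∨ (not b₁ ∧ not b₂)
    cutA  = (a₁ ∧ not a₂) ∨ (not a₁ ∧ a₂)
    cutB  = (b₁ ∧ not b₂) ∨ (not b₁ ∧ b₂)
  field
    partition : 𝟙 t ≡ 𝟙 (t ∧ inA) ℕ.+ (𝟙 (t ∧ inL) ℕ.+ (𝟙 (t ∧ inQ) ℕ.+ 𝟙 (t ∧ (cutA ∨ cutB))))
    inclusion-exclusion : 𝟙 (t ∧ cutA) ℕ.+ 𝟙 (t ∧ cutB) ≡ 𝟙 (t ∧ (cutA ∨ cutB)) ℕ.+ 𝟙 (t ∧ (cutA ∧ cutB))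
    level-ends : (if t then 𝟙 (b₁ ∧ not a₁) ℕ.+ 𝟙 (b₂ ∧ not a₂) else 0)
                   ℕ.+ (𝟙 (t ∧ (cutA ∧ cutB)) ℕ.+ 𝟙 (t ∧ (cutA ∧ cutB)))
                 ≡ (𝟙 (t ∧ inL) ℕ.+ 𝟙 (t ∧ inL)) ℕ.+ (𝟙 (t ∧ cutA) ℕ.+ 𝟙 (t ∧ cutB))

edge-identities : ∀ t a₁ b₁ a₂ b₂ → (a₁ ≡ true → b₁ ≡ true) → (a₂ ≡ true → b₂ ≡ true) → EdgeIdentities t a₁ b₁ a₂ b₂
edge-identities false _ _ _ _ _ _ = record { partition = refl ; inclusion-exclusion = refl ; level-ends = refl }
edge-identities true true false _ _ A⊆B _ with () ← A⊆B refl
edge-identities true _ _ true false _ A⊆B with () ← A⊆B refl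
edge-identities true false false false false _ _ = record { partition = refl ; inclusion-exclusion = refl ; level-ends = refl }
edge-identities true false false false true  _ _ = record { partition = refl ; inclusion-exclusion = refl ; level-ends = refl }
edge-identities true false false true  true  _ _ = record { partition = refl ; inclusion-exclusion = refl ; level-ends = refl }
edge-identities true false true  false false _ _ = record { partition = refl ; inclusion-exclusion = refl ; level-ends = refl }
edge-identities true false true  false true  _ _ = record { partition = refl ; inclusion-exclusion = refl ; level-ends = refl }
edge-identities true false true  true  true  _ _ = record { partition = refl ; inclusion-exclusion = refl ; level-ends = refl }
edge-identities true true  true  false false _ _ = record { partition = refl ; inclusion-exclusion = refl ; level-ends = refl }
edge-identities true true  true  false true  _ _ = record { partition = refl ; inclusion-exclusion = refl ; level-ends = refl }
edge-identities true true  true  true  true  _ _ = record { partition = refl ; inclusion-exclusion = refl ; level-ends = refl }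

vertex-partition : ∀ a b → (a ≡ true → b ≡ true) → 1 ≡ 𝟙 a ℕ.+ (𝟙 (b ∧ not a) ℕ.+ 𝟙 (not b))
vertex-partition true  true  _ = refl
vertex-partition true  false A⊆B with () ← A⊆B refl
vertex-partition false true  _ = refl
vertex-partition false false _ = refl

-- The level lemma for spanning trees: if a spanning tree T meets each of the
-- cuts δ(A), δ(B) of nested sets ∅ ≠ A ⊊ B ⊊ V in exactly one edge, then the
-- degree of L = B ∖ A in T is 2|L| (T restricted to L is a spanning tree of L,
-- joined to the rest of T by the two cut edges).
tree-level-degree : ∀ (G : Graph) Tr → IsSpanningTree G Tr → (A B : VSet G) → _⊆_ G A B →
  Nonempty G A → Nonempty G (_∖_ G B A) → Nonempty G (∁ G B) →
  count (λ e → Tr e ∧ δ G A e) ≡ 1 → count (λ e → Tr e ∧ δ G B e) ≡ 1 →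
  tree-degree G Tr (_∖_ G B A) ≡ count (_∖_ G B A) ℕ.+ count (_∖_ G B A)
tree-level-degree G Tr tree A B A⊆B A≠∅ L≠∅ Q≠∅ onceA onceB =
    level-arithmetic p l q u i (tree-degree G Tr L) (proj₁ slackA) (proj₁ slackL) (proj₁ slackQ) (count L)
      tree-size two-cuts degree (proj₂ slackL)
  where
  open Graph G
  open SpanningTreeSparsity G using (spanning-tree-sparse)
  L = _∖_ G B A
  Q = ∁ G B
  T∩ : ESet G → ℕ
  T∩ F = count (λ e → Tr e ∧ F e)
  p = T∩ (Eof G A)
  l = T∩ (Eof G L)
  q = T∩ (Eof G Q)
  u = T∩ (λ e → δ G A e ∨ δ G B e)
  i = T∩ (λ e → δ G A e ∧ δ G B e)

  A⇒B : ∀ v → A v ≡ true → B v ≡ true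
  A⇒B v Av = Equivalence.to T-≡ (A⊆B v (Equivalence.from T-≡ Av))
  identities : ∀ e → EdgeIdentities (Tr e) (A (ends₁ e)) (B (ends₁ e)) (A (ends₂ e)) (B (ends₂ e))
  identities e = edge-identities (Tr e) _ _ _ _ (A⇒B (ends₁ e)) (A⇒B (ends₂ e))
  open EdgeIdentities

  Σ-+₃ : ∀ {N} (f g h : Fin N → ℕ) → ℕΣ.Σ (λ j → f j ℕ.+ (g j ℕ.+ h j)) ≡ ℕΣ.Σ f ℕ.+ (ℕΣ.Σ g ℕ.+ ℕΣ.Σ h)
  Σ-+₃ f g h = trans (ℕΣ.Σ-+ f (λ j → g j ℕ.+ h j)) (cong (ℕΣ.Σ f ℕ.+_) (ℕΣ.Σ-+ g h))

  edges : count Tr ≡ p ℕ.+ (l ℕ.+ (q ℕ.+ u))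
  edges = trans (ℕΣ.Σ-cong (partition ∘ identities))
     (trans (ℕΣ.Σ-+ (λ e → 𝟙 (Tr e ∧ Eof G A e)) _)
       (cong (p ℕ.+_) (Σ-+₃ (λ e → 𝟙 (Tr e ∧ Eof G L e)) (λ e → 𝟙 (Tr e ∧ Eof G Q e)) (λ e → 𝟙 (Tr e ∧ (δ G A e ∨ δ G B e))))))

  vertices : n ≡ count A ℕ.+ (count L ℕ.+ count Q)
  vertices = trans (sym (count-all n)) (trans (ℕΣ.Σ-cong (λ v → vertex-partition (A v) (B v) (A⇒B v)))
               (Σ-+₃ (λ v → 𝟙 (A v)) (λ v → 𝟙 (L v)) (λ v → 𝟙 (Q v))))

  slackA = ℕₚ.m≤n⇒∃[o]m+o≡n (spanning-tree-sparse Tr tree A A≠∅)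
  slackL = ℕₚ.m≤n⇒∃[o]m+o≡n (spanning-tree-sparse Tr tree L L≠∅)
  slackQ = ℕₚ.m≤n⇒∃[o]m+o≡n (spanning-tree-sparse Tr tree Q Q≠∅)

  tree-size : suc (p ℕ.+ (l ℕ.+ (q ℕ.+ u)))
            ≡ (suc p ℕ.+ proj₁ slackA) ℕ.+ ((suc l ℕ.+ proj₁ slackL) ℕ.+ (suc q ℕ.+ proj₁ slackQ))
  tree-size = trans (cong suc (sym edges)) (trans (proj₂ tree) (trans vertices
                (sym (cong₂ ℕ._+_ (proj₂ slackA) (cong₂ ℕ._+_ (proj₂ slackL) (proj₂ slackQ))))))

  two-cuts : 2 ≡ u ℕ.+ i
  two-cuts = begin
    2                        ≡⟨ sym (cong₂ ℕ._+_ onceA onceB) ⟩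
    T∩ (δ G A) ℕ.+ T∩ (δ G B) ≡⟨ sym (ℕΣ.Σ-+ (λ e → 𝟙 (Tr e ∧ δ G A e)) (λ e → 𝟙 (Tr e ∧ δ G B e))) ⟩
    ℕΣ.Σ (λ e → 𝟙 (Tr e ∧ δ G A e) ℕ.+ 𝟙 (Tr e ∧ δ G B e)) ≡⟨ ℕΣ.Σ-cong (inclusion-exclusion ∘ identities) ⟩
    ℕΣ.Σ (λ e → 𝟙 (Tr e ∧ (δ G A e ∨ δ G B e)) ℕ.+ 𝟙 (Tr e ∧ (δ G A e ∧ δ G B e)))
      ≡⟨ ℕΣ.Σ-+ (λ e → 𝟙 (Tr e ∧ (δ G A e ∨ δ G B e))) (λ e → 𝟙 (Tr e ∧ (δ G A e ∧ δ G B e))) ⟩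
    u ℕ.+ i                  ∎
    where open ≡-Reasoning

  degree : tree-degree G Tr L ℕ.+ (i ℕ.+ i) ≡ (l ℕ.+ l) ℕ.+ 2
  degree = begin
    tree-degree G Tr L ℕ.+ (i ℕ.+ i)
      ≡⟨ sym (Σ-+₃ (λ e → if Tr e then 𝟙 (L (ends₁ e)) ℕ.+ 𝟙 (L (ends₂ e)) else 0)
                   (λ e → 𝟙 (Tr e ∧ (δ G A e ∧ δ G B e))) (λ e → 𝟙 (Tr e ∧ (δ G A e ∧ δ G B e)))) ⟩
    ℕΣ.Σ (λ e → (if Tr e then 𝟙 (L (ends₁ e)) ℕ.+ 𝟙 (L (ends₂ e)) else 0)
                  ℕ.+ (𝟙 (Tr e ∧ (δ G A e ∧ δ G B e)) ℕ.+ 𝟙 (Tr e ∧ (δ G A e ∧ δ G B e))))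
      ≡⟨ ℕΣ.Σ-cong (level-ends ∘ identities) ⟩
    ℕΣ.Σ (λ e → (𝟙 (Tr e ∧ Eof G L e) ℕ.+ 𝟙 (Tr e ∧ Eof G L e)) ℕ.+ (𝟙 (Tr e ∧ δ G A e) ℕ.+ 𝟙 (Tr e ∧ δ G B e)))
      ≡⟨ ℕΣ.Σ-+ (λ e → 𝟙 (Tr e ∧ Eof G L e) ℕ.+ 𝟙 (Tr e ∧ Eof G L e)) (λ e → 𝟙 (Tr e ∧ δ G A e) ℕ.+ 𝟙 (Tr e ∧ δ G B e)) ⟩
    ℕΣ.Σ (λ e → 𝟙 (Tr e ∧ Eof G L e) ℕ.+ 𝟙 (Tr e ∧ Eof G L e)) ℕ.+ ℕΣ.Σ (λ e → 𝟙 (Tr e ∧ δ G A e) ℕ.+ 𝟙 (Tr e ∧ δ G B e))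
      ≡⟨ cong₂ ℕ._+_ (ℕΣ.Σ-+ (λ e → 𝟙 (Tr e ∧ Eof G L e)) (λ e → 𝟙 (Tr e ∧ Eof G L e)))
                     (trans (ℕΣ.Σ-+ (λ e → 𝟙 (Tr e ∧ δ G A e)) (λ e → 𝟙 (Tr e ∧ δ G B e))) (cong₂ ℕ._+_ onceA onceB)) ⟩
    (l ℕ.+ l) ℕ.+ 2          ∎
    where open ≡-Reasoning

single≡== : ∀ (G : Graph) v w → single G v w ≡ (v == w)
single≡== G v w with v ≟ w
... | yes _ = refl
... | no _  = refl

handshake : ∀ (G : Graph) (L : VSet G) (Tr : ESet G) →
  ℕΣ.Σ⟨ L ⟩ (λ v → count (λ e → δv G v e ∧ Tr e)) ≡ tree-degree G Tr L
handshake G L Tr = begin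
  ℕΣ.Σ⟨ L ⟩ (λ v → count (λ e → δv G v e ∧ Tr e))
    ≡⟨ ℕΣ.Σ-cong (λ v → distribute (L v) (λ e → 𝟙 (δv G v e ∧ Tr e))) ⟩
  ℕΣ.Σ (λ v → ℕΣ.Σ (λ e → if L v then 𝟙 (δv G v e ∧ Tr e) else 0))
    ≡⟨ ℕΣ.Σ-comm (λ v e → if L v then 𝟙 (δv G v e ∧ Tr e) else 0) ⟩
  ℕΣ.Σ (λ e → ℕΣ.Σ (λ v → if L v then 𝟙 (δv G v e ∧ Tr e) else 0))
    ≡⟨ ℕΣ.Σ-cong ends-in-L ⟩
  tree-degree G Tr L ∎
  where
  open Graph G
  open ≡-Reasoning

  distribute : ∀ {N} b (f : Fin N → ℕ) → (if b then ℕΣ.Σ f else 0) ≡ ℕΣ.Σ (λ i → if b then f i else 0)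
  distribute true  f = refl
  distribute {N} false f = sym (ℕΣ.Σ-zero N)

  -- a vertex is an end of at most one side of a loopless edge
  end-indicator : ∀ b x y → ¬ (x ≡ true × y ≡ true) →
    (if b then 𝟙 (((x ∧ not y) ∨ (not x ∧ y)) ∧ true) else 0) ≡ (if x then 𝟙 b else 0) ℕ.+ (if y then 𝟙 b else 0)
  end-indicator b     true  true  both = ⊥-elim (both (refl , refl))
  end-indicator false true  false _ = refl
  end-indicator false false true  _ = refl
  end-indicator false false false _ = refl
  end-indicator true  true  false _ = refl
  end-indicator true  false true  _ = refl
  end-indicator true  false false _ = refl

  ends-in-L : ∀ e → ℕΣ.Σ (λ v → if L v then 𝟙 (δv G v e ∧ Tr e) else 0)
                   ≡ (if Tr e then 𝟙 (L (ends₁ e)) ℕ.+ 𝟙 (L (ends₂ e)) else 0)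
  ends-in-L e with Tr e
  ... | false = trans (ℕΣ.Σ-cong nothing) (ℕΣ.Σ-zero n)
    where
    nothing : ∀ v → (if L v then 𝟙 (δv G v e ∧ false) else 0) ≡ 0
    nothing v with L v
    ... | false = refl
    ... | true  = cong 𝟙 (∧-zeroʳ (δv G v e))
  ... | true = begin
      ℕΣ.Σ (λ v → if L v then 𝟙 (δv G v e ∧ true) else 0)
        ≡⟨ ℕΣ.Σ-cong split ⟩
      ℕΣ.Σ (λ v → (if v == ends₁ e then 𝟙 (L v) else 0) ℕ.+ (if v == ends₂ e then 𝟙 (L v) else 0))
        ≡⟨ ℕΣ.Σ-+ (λ v → if v == ends₁ e then 𝟙 (L v) else 0) (λ v → if v == ends₂ e then 𝟙 (L v) else 0) ⟩
      _ ≡⟨ cong₂ ℕ._+_ (ℕΣ.Σ-point (ends₁ e) (𝟙 ∘ L)) (ℕΣ.Σ-point (ends₂ e) (𝟙 ∘ L)) ⟩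
      𝟙 (L (ends₁ e)) ℕ.+ 𝟙 (L (ends₂ e)) ∎
    where
    not-both : ∀ v → ¬ ((v == ends₁ e) ≡ true × (v == ends₂ e) ≡ true)
    not-both v (v=u , v=w) = loopless e (trans (sym (==-sound v (ends₁ e) v=u)) (==-sound v (ends₂ e) v=w))
    split : ∀ v → (if L v then 𝟙 (δv G v e ∧ true) else 0)
                ≡ (if v == ends₁ e then 𝟙 (L v) else 0) ℕ.+ (if v == ends₂ e then 𝟙 (L v) else 0)
    split v = trans (cong₂ (λ x y → if L v then 𝟙 (((x ∧ not y) ∨ (not x ∧ y)) ∧ true) else 0)
                           (single≡== G v (ends₁ e)) (single≡== G v (ends₂ e)))
                    (end-indicator (L v) (v == ends₁ e) (v == ends₂ e) (not-both v))

module OrderedFieldFacts (𝔽 : OrderedField) where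
  open OrderedField 𝔽 renaming (_<_ to _<ᶠ_)
  open IsCommutativeRing isCommutativeRing
    using (+-assoc; +-comm; +-identityˡ; +-identityʳ; -‿inverseˡ; -‿inverseʳ; +-isCommutativeMonoid;
           *-assoc; *-comm; *-identityˡ; *-identityʳ; distribˡ; distribʳ; zeroʳ)
  open IsTotalOrder isTotalOrder using (total; antisym)
  open ≡-Reasoning

  ring : CommutativeRing 0ℓ 0ℓ
  ring = record { isCommutativeRing = isCommutativeRing }

  open GroupProperties (CommutativeRing.+-group ring) public using () renaming (∙-cancelˡ to +-cancelˡ)
  open RingProperties (CommutativeRing.ring ring) using (-‿distribʳ-*)

  module 𝔽Σ = Sums +-isCommutativeMonoid
  open 𝔽Σ using (Σ; Σ⟨_⟩)

  Σ-*ˡ : ∀ {N} c (f : Fin N → Carrier) → Σ (λ i → c * f i) ≡ c * Σ f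
  Σ-*ˡ c f = trans (𝔽Σ.Σ≡sum (λ i → c * f i))
               (trans (sym (SemiringSum.*-distribˡ-sum (CommutativeRing.semiring ring) c f)) (cong (c *_) (sym (𝔽Σ.Σ≡sum f))))

  ⟦+⟧ : ∀ a b → ⟦ a ℕ.+ b ⟧ ≡ ⟦ a ⟧ + ⟦ b ⟧
  ⟦+⟧ ℕ.zero b = sym (+-identityˡ _)
  ⟦+⟧ (suc a) b = trans (cong (1# +_) (⟦+⟧ a b)) (sym (+-assoc 1# ⟦ a ⟧ ⟦ b ⟧))

  ⟦Σ⟧ : ∀ {N} (f : Fin N → ℕ) → ⟦ ℕΣ.Σ f ⟧ ≡ Σ (λ i → ⟦ f i ⟧)
  ⟦Σ⟧ {ℕ.zero} f = refl
  ⟦Σ⟧ {suc N} f = trans (⟦+⟧ (f zero) _) (cong (⟦ f zero ⟧ +_) (⟦Σ⟧ (f ∘ suc)))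

  ⟦1⟧ : ⟦ 1 ⟧ ≡ 1#
  ⟦1⟧ = +-identityʳ 1#

  ⟦double⟧ : ∀ a → ⟦ a ℕ.+ a ⟧ ≡ 2# * ⟦ a ⟧
  ⟦double⟧ a = trans (⟦+⟧ a a) (sym (trans (distribʳ ⟦ a ⟧ 1# 1#) (cong₂ _+_ (*-identityˡ ⟦ a ⟧) (*-identityˡ ⟦ a ⟧))))

  Σ⟨⟩-affine : ∀ {N} (S : Fin N → Bool) (h f g : Fin N → Carrier) a b → (∀ i → h i ≡ a * f i + b * g i) →
    Σ⟨ S ⟩ h ≡ a * Σ⟨ S ⟩ f + b * Σ⟨ S ⟩ g
  Σ⟨⟩-affine {N} S h f g a b h≡ = begin
    Σ⟨ S ⟩ h                          ≡⟨ 𝔽Σ.Σ-cong pointwise ⟩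
    Σ (λ i → a * f′ i + b * g′ i)    ≡⟨ 𝔽Σ.Σ-+ (λ i → a * f′ i) (λ i → b * g′ i) ⟩
    Σ (λ i → a * f′ i) + Σ (λ i → b * g′ i) ≡⟨ cong₂ _+_ (Σ-*ˡ a f′) (Σ-*ˡ b g′) ⟩
    a * Σ⟨ S ⟩ f + b * Σ⟨ S ⟩ g       ∎
    where
    f′ g′ : Fin N → Carrier
    f′ i = if S i then f i else 0#
    g′ i = if S i then g i else 0#
    pointwise : ∀ i → (if S i then h i else 0#) ≡ a * f′ i + b * g′ i
    pointwise i with S i
    ... | true  = h≡ i
    ... | false = sym (trans (cong₂ _+_ (zeroʳ a) (zeroʳ b)) (+-identityˡ 0#))

  Σ⟨⟩-mixture : ∀ {N M} (S : Fin N → Bool) (h : Fin N → Carrier) (c : Fin M → Carrier) (f : Fin M → Fin N → Carrier) →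
    (∀ i → h i ≡ Σ (λ j → c j * f j i)) → Σ⟨ S ⟩ h ≡ Σ (λ j → c j * Σ⟨ S ⟩ (f j))
  Σ⟨⟩-mixture {N} {M} S h c f h≡ = begin
    Σ⟨ S ⟩ h                                        ≡⟨ 𝔽Σ.Σ-cong pointwise ⟩
    Σ (λ i → Σ (λ j → c j * f′ j i))                ≡⟨ 𝔽Σ.Σ-comm (λ i j → c j * f′ j i) ⟩
    Σ (λ j → Σ (λ i → c j * f′ j i))                ≡⟨ 𝔽Σ.Σ-cong (λ j → Σ-*ˡ (c j) (f′ j)) ⟩
    Σ (λ j → c j * Σ⟨ S ⟩ (f j))                    ∎
    where
    f′ : Fin M → Fin N → Carrier
    f′ j i = if S i then f j i else 0#
    pointwise : ∀ i → (if S i then h i else 0#) ≡ Σ (λ j → c j * f′ j i)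
    pointwise i with S i
    ... | true  = h≡ i
    ... | false = sym (trans (𝔽Σ.Σ-cong (λ j → zeroʳ (c j))) (𝔽Σ.Σ-zero M))

  convex-constant : ∀ {M} (c : Fin M → Carrier) K → Σ c ≡ 1# → Σ (λ j → c j * K) ≡ K
  convex-constant c K Σc≡1 =
    trans (𝔽Σ.Σ-cong (λ j → *-comm (c j) K)) (trans (Σ-*ˡ K c) (trans (cong (K *_) Σc≡1) (*-identityʳ K)))

  mixture-constant : ∀ {N M} (S : Fin N → Bool) (h : Fin N → Carrier) (c : Fin M → Carrier)
    (f : Fin M → Fin N → Carrier) K → Σ c ≡ 1# → (∀ i → h i ≡ Σ (λ j → c j * f j i)) →
    (∀ j → Σ⟨ S ⟩ (f j) ≡ K) → Σ⟨ S ⟩ h ≡ K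
  mixture-constant S h c f K Σc≡1 h≡ each = begin
    Σ⟨ S ⟩ h                    ≡⟨ Σ⟨⟩-mixture S h c f h≡ ⟩
    Σ (λ j → c j * Σ⟨ S ⟩ (f j)) ≡⟨ 𝔽Σ.Σ-cong (λ j → cong (c j *_) (each j)) ⟩
    Σ (λ j → c j * K)           ≡⟨ convex-constant c K Σc≡1 ⟩
    K                           ∎

  Σ⟨⟩-constant : ∀ {N} (S : Fin N → Bool) c → Σ⟨ S ⟩ (λ _ → c) ≡ c * ⟦ count S ⟧
  Σ⟨⟩-constant S c = begin
    Σ⟨ S ⟩ (λ _ → c)                ≡⟨ 𝔽Σ.Σ-cong scaled-indicator ⟩
    Σ (λ v → c * ⟦ 𝟙 (S v) ⟧)       ≡⟨ Σ-*ˡ c (λ v → ⟦ 𝟙 (S v) ⟧) ⟩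
    c * Σ (λ v → ⟦ 𝟙 (S v) ⟧)       ≡⟨ cong (c *_) (sym (⟦Σ⟧ (𝟙 ∘ S))) ⟩
    c * ⟦ count S ⟧                 ∎
    where
    scaled-indicator : ∀ v → (if S v then c else 0#) ≡ c * ⟦ 𝟙 (S v) ⟧
    scaled-indicator v with S v
    ... | true  = sym (trans (cong (c *_) ⟦1⟧) (*-identityʳ c))
    ... | false = sym (zeroʳ c)

  ε+[1-ε] : ∀ ε → ε + (1# - ε) ≡ 1#
  ε+[1-ε] ε = begin
    ε + (1# + - ε)   ≡⟨ cong (ε +_) (+-comm 1# (- ε)) ⟩
    ε + (- ε + 1#)   ≡⟨ sym (+-assoc ε (- ε) 1#) ⟩
    (ε + - ε) + 1#   ≡⟨ cong (_+ 1#) (-‿inverseʳ ε) ⟩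
    0# + 1#          ≡⟨ +-identityˡ 1# ⟩
    1#               ∎

  1-ε≢0 : ∀ ε → ε ≢ 1# → 1# - ε ≢ 0#
  1-ε≢0 ε ε≢1 1-ε≡0 = ε≢1 (trans (sym (+-identityʳ ε)) (trans (cong (ε +_) (sym 1-ε≡0)) (ε+[1-ε] ε)))

  *-cancelˡ : ∀ c a b → c ≢ 0# → c * a ≡ c * b → a ≡ b
  *-cancelˡ c a b c≢0 ca≡cb = begin
    a                    ≡⟨ sym (*-identityˡ a) ⟩
    1# * a               ≡⟨ cong (_* a) (sym c⁻¹c≡1) ⟩
    (c ⁻¹ * c) * a       ≡⟨ *-assoc (c ⁻¹) c a ⟩
    c ⁻¹ * (c * a)       ≡⟨ cong (c ⁻¹ *_) ca≡cb ⟩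
    c ⁻¹ * (c * b)       ≡⟨ sym (*-assoc (c ⁻¹) c b) ⟩
    (c ⁻¹ * c) * b       ≡⟨ cong (_* b) c⁻¹c≡1 ⟩
    1# * b               ≡⟨ *-identityˡ b ⟩
    b                    ∎
    where
    c⁻¹c≡1 : c ⁻¹ * c ≡ 1#
    c⁻¹c≡1 = trans (*-comm (c ⁻¹) c) (⁻¹-inverse c c≢0)

  convex-fixed : ∀ ε k t → ε ≢ 1# → k ≡ ε * k + (1# - ε) * t → t ≡ k
  convex-fixed ε k t ε≢1 k≡ = sym (*-cancelˡ (1# - ε) k t (1-ε≢0 ε ε≢1) (+-cancelˡ (ε * k) _ _ (trans (sym split-k) k≡)))
    where
    split-k : k ≡ ε * k + (1# - ε) * k
    split-k = sym (trans (sym (distribʳ k ε (1# - ε))) (trans (cong (_* k) (ε+[1-ε] ε)) (*-identityˡ k)))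

  *-monoˡ-≤ : ∀ c a b → 0# ≤ c → a ≤ b → c * a ≤ c * b
  *-monoˡ-≤ c a b 0≤c a≤b = subst₂ _≤_ (+-identityˡ (c * a)) (cancel-back (c * b) (c * a)) (+-mono-≤ (c * a) 0≤c[b-a])
    where
    cancel-back : ∀ u w → (u + - w) + w ≡ u
    cancel-back u w = trans (+-assoc u (- w) w) (trans (cong (u +_) (-‿inverseˡ w)) (+-identityʳ u))
    0≤b-a : 0# ≤ b - a
    0≤b-a = subst (_≤ b - a) (-‿inverseʳ a) (+-mono-≤ (- a) a≤b)
    0≤c[b-a] : 0# ≤ c * b - c * a
    0≤c[b-a] = subst (0# ≤_) (trans (distribˡ c b (- a)) (cong (c * b +_) (sym (-‿distribʳ-* c a)))) (*-nonneg 0≤c 0≤b-a)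

  affine-reflects-< : ∀ a c t s → 0# ≤ c → a + c * t <ᶠ a + c * s → t <ᶠ s
  affine-reflects-< a c t s 0≤c (≤′ , ≢′) with total t s
  ... | inj₁ t≤s = t≤s , (λ t≡s → ≢′ (cong (λ z → a + c * z) t≡s))
  ... | inj₂ s≤t = ⊥-elim (≢′ (antisym ≤′ (+-mono-a (*-monoˡ-≤ c s t 0≤c s≤t))))
    where
    +-mono-a : ∀ {u w} → u ≤ w → a + u ≤ a + w
    +-mono-a {u} {w} u≤w = subst₂ _≤_ (+-comm u a) (+-comm w a) (+-mono-≤ a u≤w)

  2-ε≡mixture : ∀ ε → 2# - ε ≡ ε * 1# + (1# - ε) * 2#
  2-ε≡mixture ε = sym (begin
    ε * 1# + (1# - ε) * (1# + 1#)                 ≡⟨ cong₂ _+_ (*-identityʳ ε) (distribˡ (1# - ε) 1# 1#) ⟩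
    ε + ((1# - ε) * 1# + (1# - ε) * 1#)           ≡⟨ cong (λ z → ε + (z + z)) (*-identityʳ (1# - ε)) ⟩
    ε + ((1# - ε) + (1# - ε))                     ≡⟨ sym (+-assoc ε (1# - ε) (1# - ε)) ⟩
    (ε + (1# - ε)) + (1# - ε)                     ≡⟨ cong (_+ (1# - ε)) (ε+[1-ε] ε) ⟩
    1# + (1# + - ε)                               ≡⟨ sym (+-assoc 1# 1# (- ε)) ⟩
    2# - ε                                        ∎)

  mixture-below-2-ε : ∀ ε t → ε <ᶠ 1# → ε * 1# + (1# - ε) * t <ᶠ 2# - ε → t <ᶠ 2#
  mixture-below-2-ε ε t (ε≤1 , _) below =
    affine-reflects-< (ε * 1#) (1# - ε) t 2# 0≤1-ε (subst (ε * 1# + (1# - ε) * t <ᶠ_) (2-ε≡mixture ε) below)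
    where
    0≤1-ε : 0# ≤ 1# - ε
    0≤1-ε = subst (_≤ 1# - ε) (-‿inverseʳ ε) (+-mono-≤ (- ε) ε≤1)

  1<2-ε : ∀ ε → ε <ᶠ 1# → 1# <ᶠ 2# - ε
  1<2-ε ε (ε≤1 , ε≢1) =
    subst₂ _≤_ (ε+[1-ε] ε) (sym (+-assoc 1# 1# (- ε))) (+-mono-≤ (1# - ε) ε≤1) ,
    (λ 1≡2-ε → 1-ε≢0 ε ε≢1 (sym (+-cancelˡ 1# 0# (1# - ε) (trans (+-identityʳ 1#) (trans 1≡2-ε (+-assoc 1# 1# (- ε)))))))

⊆-trans : ∀ (G : Graph) {A B C : VSet G} → _⊆_ G A B → _⊆_ G B C → _⊆_ G A C
⊆-trans G A⊆B B⊆C v v∈A = B⊆C v (A⊆B v v∈A)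

⊆-⊊-trans : ∀ (G : Graph) {A B C : VSet G} → _⊆_ G A B → _⊊_ G B C → _⊊_ G A C
⊆-⊊-trans G A⊆B (B⊆C , v , v∈C , v∉B) = ⊆-trans G A⊆B B⊆C , v , v∈C , (v∉B ∘ A⊆B v)

¬T⇒T-not : ∀ {b} → ¬ T b → T (not b)
¬T⇒T-not {true}  ¬t = ¬t tt
¬T⇒T-not {false} _  = tt

⊊-difference : ∀ (G : Graph) {A B : VSet G} → _⊊_ G A B → Nonempty G (_∖_ G B A)
⊊-difference G (_ , v , v∈B , v∉A) = v , Equivalence.from T-∧ (v∈B , ¬T⇒T-not v∉A)

module ChainFacts (G : Graph) {k : ℕ} (V : Fin (suc k) → VSet G) (chain : IsChain G k V) where
  private
    step : ∀ (i : Fin k) → _⊊_ G (V (F.inject₁ i)) (V (suc i))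
    step = proj₁ (proj₂ chain)

  ascending : ∀ {i j} → i F.≤ j → _⊆_ G (V i) (V j)
  ascending = nested-ascending V (proj₁ ∘ step)

  strictly-ascending : ∀ {i j} → i < j → _⊊_ G (V i) (V j)
  strictly-ascending {i} {suc j} i<j =
    ⊆-⊊-trans G (ascending (subst (F.toℕ i ℕ.≤_) (sym (FP.toℕ-inject₁ j)) (ℕ.s≤s⁻¹ i<j))) (step j)

  nonempty : ∀ i → Nonempty G (V i)
  nonempty i with proj₁ chain
  ... | v , v∈V₀ = v , ascending z≤n v v∈V₀

  co-nonempty : ∀ i → Nonempty G (∁ G (V i))
  co-nonempty i with proj₂ (proj₂ chain)
  ... | _ , v , _ , v∉Vₖ = v , ¬T⇒T-not (v∉Vₖ ∘ ascending (FP.≤fromℕ i) v)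

subchain : ∀ (G : Graph) {k m} {V : Fin (suc k) → VSet G} (σ : Fin (suc m) → Fin (suc k)) →
  IsChain G k V → (∀ i j → i < j → σ i < σ j) → IsChain G m (V ∘ σ)
subchain G {k} {m} {V} σ chain increasing =
  nonempty (σ zero) ,
  (λ i → strictly-ascending (increasing (F.inject₁ i) (suc i) (inject₁<suc i))) ,
  ⊆-⊊-trans G (ascending (FP.≤fromℕ (σ (F.fromℕ m)))) (proj₂ (proj₂ chain))
  where open ChainFacts G V chain

increasing-first : ∀ {k m} (σ : Fin (suc m) → Fin (suc k)) → (∀ i j → i < j → σ i < σ j) →
  ∀ j → σ j ≡ zero → σ zero ≡ zero
increasing-first σ increasing zero σj≡0 = σj≡0
increasing-first σ increasing (suc j) σj≡0 =
  ⊥-elim (ℕₚ.n≮0 (subst (λ z → F.toℕ (σ zero) ℕ.< F.toℕ z) σj≡0 (increasing zero (suc j) (s≤s z≤n))))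

increasing-last : ∀ {k m} (σ : Fin (suc m) → Fin (suc k)) → (∀ i j → i < j → σ i < σ j) →
  ∀ j → σ j ≡ F.fromℕ k → σ (F.fromℕ m) ≡ F.fromℕ k
increasing-last {k} {m} σ increasing j σj≡k with ℕₚ.m≤n⇒m<n∨m≡n (FP.≤fromℕ j)
... | inj₂ j≡m = trans (cong σ (sym (FP.toℕ-injective j≡m))) σj≡k
... | inj₁ j<m = ⊥-elim (ℕₚ.<-irrefl refl (ℕₚ.<-≤-trans k<σm (subst (F.toℕ (σ (F.fromℕ m)) ℕ.≤_) (FP.toℕ-fromℕ k) (FP.≤fromℕ (σ (F.fromℕ m))))))
  where
  k<σm : k ℕ.< F.toℕ (σ (F.fromℕ m))
  k<σm = subst (ℕ._< F.toℕ (σ (F.fromℕ m))) (trans (cong F.toℕ σj≡k) (FP.toℕ-fromℕ k)) (increasing j (F.fromℕ m) j<m)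

module Weights (𝔽 : OrderedField) (G : Graph) where
  open OrderedField 𝔽 renaming (_<_ to _<ᶠ_)
  open OrderedFieldFacts 𝔽
  open 𝔽Σ using (Σ⟨_⟩)
  open Graph G

  degree : Vec𝔽 G 𝔽 → VSet G → Carrier
  degree x S = Σ⟨ S ⟩ (λ v → _⟨_⟩ G 𝔽 x (δv G v))

  χ-value : ∀ Tr F → _⟨_⟩ G 𝔽 (χ G 𝔽 Tr) F ≡ ⟦ count (λ e → F e ∧ Tr e) ⟧
  χ-value Tr F = trans (𝔽Σ.Σ-cong pointwise) (sym (⟦Σ⟧ (λ e → 𝟙 (F e ∧ Tr e))))
    where
    pointwise : ∀ e → (if F e then (if Tr e then 1# else 0#) else 0#) ≡ ⟦ 𝟙 (F e ∧ Tr e) ⟧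
    pointwise e with F e | Tr e
    ... | true  | true  = sym ⟦1⟧
    ... | true  | false = refl
    ... | false | _     = refl

  χ-degree : ∀ Tr L → degree (χ G 𝔽 Tr) L ≡ ⟦ tree-degree G Tr L ⟧
  χ-degree Tr L = trans (𝔽Σ.Σ-cong pointwise)
    (trans (sym (⟦Σ⟧ (λ v → if L v then count (λ e → δv G v e ∧ Tr e) else 0))) (cong ⟦_⟧ (handshake G L Tr)))
    where
    pointwise : ∀ v → (if L v then _⟨_⟩ G 𝔽 (χ G 𝔽 Tr) (δv G v) else 0#)
                    ≡ ⟦ (if L v then count (λ e → δv G v e ∧ Tr e) else 0) ⟧
    pointwise v with L v
    ... | true  = χ-value Tr (δv G v)
    ... | false = refl

  module _ {k : ℕ} (V : Fin (suc k) → VSet G) where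

    gao-cut : ∀ {Tr} → IsGaoTree G k V Tr → ∀ i → _⟨_⟩ G 𝔽 (χ G 𝔽 Tr) (δ G (V i)) ≡ 1#
    gao-cut {Tr} (_ , once) i = trans (χ-value Tr (δ G (V i)))
      (trans (cong ⟦_⟧ (trans (ℕΣ.Σ-cong (λ e → cong 𝟙 (∧-comm (δ G (V i) e) (Tr e)))) (once i))) ⟦1⟧)

    gao-level : ∀ {Tr} → IsChain G k V → IsGaoTree G k V Tr → ∀ {a b} → a < b →
      degree (χ G 𝔽 Tr) (_∖_ G (V b) (V a)) ≡ 2# * ⟦ count (_∖_ G (V b) (V a)) ⟧
    gao-level {Tr} chain (tree , once) {a} {b} a<b = begin
      degree (χ G 𝔽 Tr) L            ≡⟨ χ-degree Tr L ⟩
      ⟦ tree-degree G Tr L ⟧         ≡⟨ cong ⟦_⟧ (tree-level-degree G Tr tree (V a) (V b) (proj₁ Va⊊Vb)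
                                          (nonempty a) (⊊-difference G Va⊊Vb) (co-nonempty b) (once a) (once b)) ⟩
      ⟦ count L ℕ.+ count L ⟧        ≡⟨ ⟦double⟧ (count L) ⟩
      2# * ⟦ count L ⟧               ∎
      where
      open ChainFacts G V chain
      open ≡-Reasoning
      L = _∖_ G (V b) (V a)
      Va⊊Vb = strictly-ascending a<b

    SpC-cut : ∀ {y} → InSpC G 𝔽 k V y → ∀ i → _⟨_⟩ G 𝔽 y (δ G (V i)) ≡ 1#
    SpC-cut {y} (_ , λs , Ts , _ , gao , Σλ≡1 , y≡) i =
      mixture-constant (δ G (V i)) y λs (χ G 𝔽 ∘ Ts) 1# Σλ≡1 y≡ (λ j → gao-cut (gao j) i)

    SpC-level : ∀ {y} → IsChain G k V → InSpC G 𝔽 k V y → ∀ {a b} → a < b →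
      degree y (_∖_ G (V b) (V a)) ≡ 2# * ⟦ count (_∖_ G (V b) (V a)) ⟧
    SpC-level {y} chain (_ , λs , Ts , _ , gao , Σλ≡1 , y≡) a<b =
      mixture-constant _ (λ v → _⟨_⟩ G 𝔽 y (δv G v)) λs (λ j v → _⟨_⟩ G 𝔽 (χ G 𝔽 (Ts j)) (δv G v)) _ Σλ≡1
        (λ v → Σ⟨⟩-mixture (δv G v) y λs (χ G 𝔽 ∘ Ts) y≡) (λ j → gao-level chain (gao j) a<b)

    chainpoint-level : ∀ {x} → IsChainPoint G 𝔽 k V x → ∀ {a b} → a F.≤ b →
      degree x (_∖_ G (V b) (V a)) ≡ 2# * ⟦ count (_∖_ G (V b) (V a)) ⟧
    chainpoint-level {x} (chain , _ , _ , _ , _ , levels) {a} {b} a≤b =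
      trans (𝔽Σ.Σ⟨⟩-levels-agree +-cancelˡ V (λ v → _⟨_⟩ G 𝔽 x (δv G v)) (λ _ → 2#) (proj₁ ∘ proj₁ (proj₂ chain))
               (λ j → trans (levels j) (sym (Σ⟨⟩-constant (_∖_ G (V (suc j)) (V (F.inject₁ j))) 2#))) a≤b)
            (Σ⟨⟩-constant (_∖_ G (V b) (V a)) 2#)

  module Decomposition {x y z : Vec𝔽 G 𝔽} {a b : Carrier} (x≡ : ∀ e → x e ≡ a * y e + b * z e) where

    value-split : ∀ F → _⟨_⟩ G 𝔽 x F ≡ a * _⟨_⟩ G 𝔽 y F + b * _⟨_⟩ G 𝔽 z F
    value-split F = Σ⟨⟩-affine F x y z a b x≡

    degree-split : ∀ S → degree x S ≡ a * degree y S + b * degree z S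
    degree-split S = Σ⟨⟩-affine S _ _ _ a b (λ v → value-split (δv G v))

  module Split {k : ℕ} (V : Fin (suc k) → VSet G) {x y x′ : Vec𝔽 G 𝔽} {ε : Carrier} (ε<1 : ε <ᶠ 1#)
               (x≡ : ∀ e → x e ≡ ε * y e + (1# - ε) * x′ e) (y∈SpC : InSpC G 𝔽 k V y) where
    open Decomposition x≡

    cut : Vec𝔽 G 𝔽 → Fin (suc k) → Carrier
    cut z i = _⟨_⟩ G 𝔽 z (δ G (V i))

    -- y is 1 on every chain cut, so x(δ(Vᵢ)) = ε + (1 - ε) x′(δ(Vᵢ)).
    cut-split : ∀ i → cut x i ≡ ε * 1# + (1# - ε) * cut x′ i
    cut-split i = trans (value-split (δ G (V i))) (cong (λ t → ε * t + (1# - ε) * cut x′ i) (SpC-cut V y∈SpC i))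

    cut-1 : ∀ i → cut x i ≡ 1# → cut x′ i ≡ 1#
    cut-1 i x≡1 = convex-fixed ε 1# (cut x′ i) (proj₂ ε<1) (trans (sym x≡1) (cut-split i))

    cut-below : ∀ i → cut x i <ᶠ 2# - ε → cut x′ i <ᶠ 2#
    cut-below i below = mixture-below-2-ε ε (cut x′ i) ε<1 (subst (_<ᶠ 2# - ε) (cut-split i) below)

    -- On a chain difference L both x and y have degree 2|L|, hence so does x′.
    level : IsChainPoint G 𝔽 k V x → ∀ {a b} → a < b →
      degree x′ (_∖_ G (V b) (V a)) ≡ 2# * ⟦ count (_∖_ G (V b) (V a)) ⟧
    level x-point@(chain , _) {a} {b} a<b = convex-fixed ε _ _ (proj₂ ε<1)
      (trans (sym (chainpoint-level V x-point (ℕₚ.<⇒≤ a<b)))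
        (trans (degree-split L) (cong (λ t → ε * t + (1# - ε) * degree x′ L) (SpC-level V chain y∈SpC a<b))))
      where
      L = _∖_ G (V b) (V a)

lemma2 : (𝔽 : OrderedField) (G : Graph) (k : ℕ) (V : Fin (suc k) → VSet G)
    (x y x′ : Vec𝔽 G 𝔽) (ε : OrderedField.Carrier 𝔽) →
    IsChainPoint G 𝔽 k V x →
    InSpC G 𝔽 k V y →
    InSp G 𝔽 x′ →
    OrderedField._≤_ 𝔽 (OrderedField.0# 𝔽) ε →
    OrderedField._<_ 𝔽 ε (OrderedField.1# 𝔽) →
    (∀ e → x e ≡ OrderedField._+_ 𝔽 (OrderedField._*_ 𝔽 ε (y e))
                   (OrderedField._*_ 𝔽 (OrderedField._-_ 𝔽 (OrderedField.1# 𝔽) ε) (x′ e))) →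
    (m : ℕ) (σ : Fin (suc m) → Fin (suc k)) →
    (∀ i j → i < j → σ i < σ j) →
    (∀ i → (OrderedField._<_ 𝔽 (_⟨_⟩ G 𝔽 x (δ G (V i)))
                               (OrderedField._-_ 𝔽 (OrderedField.2# 𝔽) ε))
           ⇔ (∃[ j ] σ j ≡ i)) →
    IsChainPoint G 𝔽 m (V ∘ σ) x′
lemma2 𝔽 G k V x y x′ ε x-point@(chain , _ , x-first , x-last , _ , _) y∈SpC x′∈Sp _ ε<1 x≡ m σ increasing selected =
  subchain G {V = V} σ chain increasing , x′∈Sp , first , last , middle , levels
  where
  open OrderedField 𝔽 using (_*_; _-_; 1#; 2#; ⟦_⟧) renaming (_<_ to _<ᶠ_)
  open OrderedFieldFacts 𝔽 using (1<2-ε)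
  open Weights 𝔽 G
  open Split V ε<1 x≡ y∈SpC

  -- A cut where x is 1 < 2 - ε is retained by σ.
  retained : ∀ i → cut x i ≡ 1# → ∃[ j ] σ j ≡ i
  retained i x≡1 = Equivalence.to (selected i) (subst (_<ᶠ 2# - ε) (sym x≡1) (1<2-ε ε ε<1))

  first : cut x′ (σ zero) ≡ 1#
  first rewrite increasing-first σ increasing _ (proj₂ (retained zero x-first)) = cut-1 zero x-first

  last : cut x′ (σ (F.fromℕ m)) ≡ 1#
  last rewrite increasing-last σ increasing _ (proj₂ (retained (F.fromℕ k) x-last)) = cut-1 (F.fromℕ k) x-last

  middle : ∀ i → 0 ℕ.< F.toℕ i → F.toℕ i ℕ.< m → cut x′ (σ i) <ᶠ 2#
  middle i _ _ = cut-below (σ i) (Equivalence.from (selected (σ i)) (i , refl))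

  levels : ∀ i → degree x′ (_∖_ G (V (σ (suc i))) (V (σ (F.inject₁ i))))
                 ≡ 2# * ⟦ count (_∖_ G (V (σ (suc i))) (V (σ (F.inject₁ i)))) ⟧
  levels i = level x-point (increasing (F.inject₁ i) (suc i) (inject₁<suc i))
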